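{- Let $K_n$ be the complete graph of order $n\ge 3$ and let $\sigma: V(G_1)\to V(G_2)$ be a bijection, where $G_1,G_2$ are disjoint copies of $K_n$. Then $Z(C(K_n,\sigma))=n$.
   Context: Zero forcing: color each vertex of a graph $H$ black or white, with $S$ the initial set of black vertices. The color-change rule turns a white vertex $u_2$ black if $u_2$ is the only white neighbor of some black vertex $u_1$. $S$ is a zero forcing set of $H$ if all vertices become black after finitely many applications of the rule. $Z(H)$ is the minimum size of a zero forcing set of $H$. Functigraph: given disjoint copies $G_1,G_2$ of $G$ and $f:V(G_1)\to V(G_2)$, $C(G,f)$ has vertex set $V(G_1)\cup V(G_2)$ and edge set $E(G_1)\cup E(G_2)\cup\{uv \mid v=f(u)\}$. -}

module Defs where

open import Data.Nat using (ℕ; _+_)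
open import Data.Fin using (Fin; splitAt)
open import Data.Fin.Subset using (Subset; _∈_; ∣_∣)
open import Data.Sum using (_⊎_; inj₁; inj₂)
open import Data.Empty using (⊥)
open import Relation.Nullary using (¬_)
open import Relation.Binary.PropositionalEquality using (_≡_; _≢_)
open import Data.Product using (_×_; Σ)

record Graph (m : ℕ) : Set₁ where
  field
    Adj   : Fin m → Fin m → Set
    sym   : ∀ {u v} → Adj u v → Adj v u
    irrefl : ∀ {u} → ¬ Adj u u
open Graph public

-- Vertices that eventually become black starting from the black set S,
-- by finitely many applications of the color-change rule:
-- a white v turns black if it is the only white neighbour of a black u.
data Black {m : ℕ} (H : Graph m) (S : Subset m) : Fin m → Set where
  initial : ∀ {v} → v ∈ S → Black H S v
  force   : ∀ {u v} → Black H S u → Adj H u v →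
            (∀ w → Adj H u w → w ≢ v → Black H S w) →
            Black H S v

IsZeroForcingSet : {m : ℕ} → Graph m → Subset m → Set
IsZeroForcingSet H S = ∀ v → Black H S v

ZeroForcingNumber≡ : {m : ℕ} → Graph m → ℕ → Set
ZeroForcingNumber≡ {m} H k =
  Σ (Subset m) (λ S → IsZeroForcingSet H S × ∣ S ∣ ≡ k)
  × (∀ S → IsZeroForcingSet H S → k Data.Nat.≤ ∣ S ∣)

K : (n : ℕ) → Graph n
K n = record { Adj = λ u v → u ≢ v
             ; sym = λ p q → p (Relation.Binary.PropositionalEquality.sym q)
             ; irrefl = λ p → p Relation.Binary.PropositionalEquality.refl }

-- Functigraph C(G,f): vertex i < n of Fin (n + n) is the copy in G₁,
-- vertex n + i is the copy in G₂.
FAdj : {n : ℕ} → Graph n → (Fin n → Fin n) → Fin n ⊎ Fin n → Fin n ⊎ Fin n → Set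
FAdj G f (inj₁ u) (inj₁ v) = Adj G u v
FAdj G f (inj₂ u) (inj₂ v) = Adj G u v
FAdj G f (inj₁ u) (inj₂ v) = v ≡ f u
FAdj G f (inj₂ v) (inj₁ u) = v ≡ f u

FAdj-sym : {n : ℕ} (G : Graph n) (f : Fin n → Fin n) → ∀ x y → FAdj G f x y → FAdj G f y x
FAdj-sym G f (inj₁ u) (inj₁ v) p = Graph.sym G p
FAdj-sym G f (inj₁ u) (inj₂ v) p = p
FAdj-sym G f (inj₂ u) (inj₁ v) p = p
FAdj-sym G f (inj₂ u) (inj₂ v) p = Graph.sym G p

FAdj-irrefl : {n : ℕ} (G : Graph n) (f : Fin n → Fin n) → ∀ x → ¬ FAdj G f x x
FAdj-irrefl G f (inj₁ u) = irrefl G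
FAdj-irrefl G f (inj₂ u) = irrefl G

C : {n : ℕ} → Graph n → (Fin n → Fin n) → Graph (n + n)
C {n} G f = record
  { Adj = λ x y → FAdj G f (splitAt n x) (splitAt n y)
  ; sym = λ {x} {y} → FAdj-sym G f (splitAt n x) (splitAt n y)
  ; irrefl = λ {x} → FAdj-irrefl G f (splitAt n x) }

-- Every vertex of C(K_n, σ) has degree n: n − 1 inside its copy of K_n plus
-- at least one edge to the other copy, since σ is onto.  Taking the first
-- force performed from a zero forcing set S, the forcing vertex and all its
-- neighbours but the forced one lie in S, so |S| ≥ n.  Conversely, once all
-- of G₁ is black, each u ∈ V(G₁) has σ(u) as its only white neighbour and
-- forces it, so V(G₁) is a zero forcing set of size n.
module Submission where

open import Data.Empty using (⊥-elim)
open import Data.Fin using (Fin; zero; splitAt; join; _↑ˡ_; _≟_)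
open import Data.Fin.Properties using (any?; all?; ¬∀⟶∃¬; splitAt-↑ˡ; join-splitAt)
open import Data.Fin.Subset
  using (Subset; inside; outside; _∈_; _∉_; _⊆_; _∪_; _-_; ∁; ⁅_⁆; ⊤; ⊥; ∣_∣)
open import Data.Fin.Subset.Properties
  using ( _∈?_; p⊆q⇒∣p∣≤∣q∣; ∣⁅x⁆∣≡1; x∈p⇒∣p-x∣<∣p∣; x∈p∪q⁺; x∈⁅x⁆; x∈⁅y⁆⇒x≡y
        ; x∈p∧x≢y⇒x∈p-y; x∈∁p⇒x∉p; x∉⁅y⁆⇒x≢y; ∣∁p∣≡n∸∣p∣; ∣⊤∣≡n; ∣⊥∣≡0; ∈⊤)
open import Data.Nat using (ℕ; zero; suc; _+_; _∸_; _≤_; z≤n; s≤s)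
open import Data.Nat.Properties
  using (≤-trans; ≤-reflexive; +-suc; +-comm; +-monoʳ-≤; n≤1+n; +-identityʳ; module ≤-Reasoning)
open import Data.Product using (_,_; proj₁; proj₂)
open import Data.Sum using (inj₁; inj₂; [_,_]′)
open import Data.Vec using ([]; _∷_; _++_)
open import Data.Vec.Properties using (lookup-splitAt; []=⇒lookup; lookup⇒[]=)
open import Function.Bundles using (_⤖_; Bijection)
open import Function.Definitions using (StrictlySurjective)
open import Relation.Binary.PropositionalEquality
  using (_≡_; _≢_; refl; sym; trans; cong; cong₂; subst; module ≡-Reasoning)
open import Relation.Nullary using (Dec; yes; no; ¬?; _×-dec_)
open import Relation.Nullary.Decidable using (decidable-stable)

open import Defs hiding (sym)

private
  variable
    m k : ℕ

∣p++q∣≡∣p∣+∣q∣ : ∀ (p : Subset m) (q : Subset k) → ∣ p ++ q ∣ ≡ ∣ p ∣ + ∣ q ∣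
∣p++q∣≡∣p∣+∣q∣ []            q = refl
∣p++q∣≡∣p∣+∣q∣ (inside  ∷ p) q = cong suc (∣p++q∣≡∣p∣+∣q∣ p q)
∣p++q∣≡∣p∣+∣q∣ (outside ∷ p) q = ∣p++q∣≡∣p∣+∣q∣ p q

∣p∪q∣≤∣p∣+∣q∣ : ∀ (p q : Subset m) → ∣ p ∪ q ∣ ≤ ∣ p ∣ + ∣ q ∣
∣p∪q∣≤∣p∣+∣q∣ []            []            = z≤n
∣p∪q∣≤∣p∣+∣q∣ (inside  ∷ p) (outside ∷ q) = s≤s (∣p∪q∣≤∣p∣+∣q∣ p q)
∣p∪q∣≤∣p∣+∣q∣ (inside  ∷ p) (inside  ∷ q) =
  s≤s (≤-trans (∣p∪q∣≤∣p∣+∣q∣ p q) (+-monoʳ-≤ ∣ p ∣ (n≤1+n ∣ q ∣)))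
∣p∪q∣≤∣p∣+∣q∣ (outside ∷ p) (inside  ∷ q) =
  ≤-trans (s≤s (∣p∪q∣≤∣p∣+∣q∣ p q)) (≤-reflexive (sym (+-suc ∣ p ∣ ∣ q ∣)))
∣p∪q∣≤∣p∣+∣q∣ (outside ∷ p) (outside ∷ q) = ∣p∪q∣≤∣p∣+∣q∣ p q

∈-++⁻ : ∀ (p : Subset m) (q : Subset k) {w} → w ∈ p ++ q → [ _∈ p , _∈ q ]′ (splitAt m w)
∈-++⁻ {m} p q {w} w∈ with splitAt m w | lookup-splitAt m p q w | []=⇒lookup w∈
... | inj₁ i | eq | look = lookup⇒[]= i p (trans (sym eq) look)
... | inj₂ j | eq | look = lookup⇒[]= j q (trans (sym eq) look)

∈-++⁺ : ∀ (p : Subset m) (q : Subset k) {w} → [ _∈ p , _∈ q ]′ (splitAt m w) → w ∈ p ++ q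
∈-++⁺ {m} p q {w} h with splitAt m w | lookup-splitAt m p q w
... | inj₁ i | eq = lookup⇒[]= w (p ++ q) (trans eq ([]=⇒lookup h))
... | inj₂ j | eq = lookup⇒[]= w (p ++ q) (trans eq ([]=⇒lookup h))

p⊆⁅y⁆∪q-x⇒∣p∣≤∣q∣ : ∀ {p q : Subset m} {x y} → x ∈ q → p ⊆ ⁅ y ⁆ ∪ (q - x) → ∣ p ∣ ≤ ∣ q ∣
p⊆⁅y⁆∪q-x⇒∣p∣≤∣q∣ {p = p} {q} {x} {y} x∈q p⊆ = begin
  ∣ p ∣                 ≤⟨ p⊆q⇒∣p∣≤∣q∣ p⊆ ⟩
  ∣ ⁅ y ⁆ ∪ (q - x) ∣   ≤⟨ ∣p∪q∣≤∣p∣+∣q∣ ⁅ y ⁆ (q - x) ⟩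
  ∣ ⁅ y ⁆ ∣ + ∣ q - x ∣ ≡⟨ cong (_+ ∣ q - x ∣) (∣⁅x⁆∣≡1 y) ⟩
  suc ∣ q - x ∣         ≤⟨ x∈p⇒∣p-x∣<∣p∣ x∈q ⟩
  ∣ q ∣                 ∎
  where open ≤-Reasoning

module _ (H : Graph m) (Adj? : ∀ u w → Dec (Adj H u w)) (S : Subset m) where

  record InitialForce : Set where
    field
      forcer forced : Fin m
      forcer∈S      : forcer ∈ S
      adjacent      : Adj H forcer forced
      others∈S      : ∀ w → Adj H forcer w → w ≢ forced → w ∈ S

  black∉⇒initialForce : ∀ {v} → Black H S v → v ∉ S → InitialForce
  black∉⇒initialForce (initial v∈S) v∉S = ⊥-elim (v∉S v∈S)
  black∉⇒initialForce (force {u} {v} black-u u~v rest) _ with u ∈? S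
  ... | no u∉S = black∉⇒initialForce black-u u∉S
  ... | yes u∈S with any? (λ w → Adj? u w ×-dec ¬? (w ≟ v) ×-dec ¬? (w ∈? S))
  ...   | yes (w , u~w , w≢v , w∉S) = black∉⇒initialForce (rest w u~w w≢v) w∉S
  ...   | no none = record
    { forcer = u ; forced = v ; forcer∈S = u∈S ; adjacent = u~v
    ; others∈S = λ w u~w w≢v →
        decidable-stable (w ∈? S) (λ w∉S → none (w , u~w , w≢v , w∉S)) }

  module _ (N : Fin m → Subset m) (N⇒Adj : ∀ {u w} → w ∈ N u → Adj H u w) where

    initialForce⇒∣N∣≤∣S∣ : (F : InitialForce) → ∣ N (InitialForce.forcer F) ∣ ≤ ∣ S ∣
    initialForce⇒∣N∣≤∣S∣ F = p⊆⁅y⁆∪q-x⇒∣p∣≤∣q∣ forcer∈S N⊆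
      where
      open InitialForce F
      N⊆ : N forcer ⊆ ⁅ forced ⁆ ∪ (S - forcer)
      N⊆ {w} w∈N with w ≟ forced
      ... | yes refl = x∈p∪q⁺ (inj₁ (x∈⁅x⁆ w))
      ... | no w≢forced = x∈p∪q⁺ (inj₂ (x∈p∧x≢y⇒x∈p-y
              (others∈S w (N⇒Adj w∈N) w≢forced)
              (λ { refl → irrefl H (N⇒Adj w∈N) })))

    δ≤∣zeroForcingSet∣ : ∀ {δ} → (∀ u → δ ≤ ∣ N u ∣) → Fin m → IsZeroForcingSet H S → δ ≤ ∣ S ∣
    δ≤∣zeroForcingSet∣ δ≤∣N∣ u zfs with all? (_∈? S)
    ... | yes all∈S = ≤-trans (δ≤∣N∣ u) (p⊆q⇒∣p∣≤∣q∣ {p = N u} (λ {w} _ → all∈S w))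
    ... | no ¬all∈S with ¬∀⟶∃¬ m (_∈ S) (_∈? S) ¬all∈S
    ...   | v , v∉S = ≤-trans (δ≤∣N∣ (InitialForce.forcer F)) (initialForce⇒∣N∣≤∣S∣ F)
      where F = black∉⇒initialForce (zfs v) v∉S

splitAt-injective : ∀ m {k} {x y : Fin (m + k)} → splitAt m x ≡ splitAt m y → x ≡ y
splitAt-injective m {k} {x} {y} eq = begin
  x                       ≡⟨ join-splitAt m k x ⟨
  join m k (splitAt m x)  ≡⟨ cong (join m k) eq ⟩
  join m k (splitAt m y)  ≡⟨ join-splitAt m k y ⟩
  y                       ∎
  where open ≡-Reasoning

firstCopy : ∀ n → Subset (n + n)
firstCopy n = ⊤ {n} ++ ⊥ {n}

∣firstCopy∣≡n : ∀ n → ∣ firstCopy n ∣ ≡ n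
∣firstCopy∣≡n n = begin
  ∣ ⊤ {n} ++ ⊥ {n} ∣       ≡⟨ ∣p++q∣≡∣p∣+∣q∣ (⊤ {n}) (⊥ {n}) ⟩
  ∣ ⊤ {n} ∣ + ∣ ⊥ {n} ∣    ≡⟨ cong₂ _+_ (∣⊤∣≡n n) (∣⊥∣≡0 n) ⟩
  n + 0                    ≡⟨ +-identityʳ n ⟩
  n                        ∎
  where open ≡-Reasoning

∈firstCopy : ∀ {n x a} → splitAt n x ≡ inj₁ a → x ∈ firstCopy n
∈firstCopy {n} x≡ = ∈-++⁺ (⊤ {n}) (⊥ {n}) (subst [ _∈ ⊤ , _∈ ⊥ ]′ (sym x≡) ∈⊤)

module _ {n} (G : Graph n) (f : Fin n → Fin n) where

  C-Adj? : (∀ u w → Dec (Adj G u w)) → ∀ x y → Dec (Adj (C G f) x y)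
  C-Adj? G? x y = FAdj? (splitAt n x) (splitAt n y)
    where
    FAdj? : ∀ x y → Dec (FAdj G f x y)
    FAdj? (inj₁ u) (inj₁ w) = G? u w
    FAdj? (inj₂ u) (inj₂ w) = G? u w
    FAdj? (inj₁ u) (inj₂ w) = w ≟ f u
    FAdj? (inj₂ w) (inj₁ u) = w ≟ f u

  module _ (f-onto : StrictlySurjective _≡_ f) where

    firstCopy-isZeroForcingSet : IsZeroForcingSet (C G f) (firstCopy n)
    firstCopy-isZeroForcingSet x with splitAt n x in x≡
    ... | inj₁ a = initial (∈firstCopy x≡)
    ... | inj₂ b with f-onto b
    ...   | a , refl = force (initial (∈firstCopy (splitAt-↑ˡ n a n))) a~x others
      where
      a~x : Adj (C G f) (a ↑ˡ n) x
      a~x rewrite splitAt-↑ˡ n a n | x≡ = refl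
      others : ∀ w → Adj (C G f) (a ↑ˡ n) w → w ≢ x → Black (C G f) (firstCopy n) w
      others w a~w w≢x with splitAt n w in w≡
      ... | inj₁ i = initial (∈firstCopy w≡)
      ... | inj₂ j =
        ⊥-elim (w≢x (splitAt-injective n (trans w≡ (trans (cong inj₂ j≡fa) (sym x≡)))))
        where
        j≡fa : j ≡ f a
        j≡fa = subst (λ y → FAdj G f y (inj₂ j)) (splitAt-↑ˡ n a n) a~w

    module _ (N : Fin n → Subset n) where

      C-neighbours : Fin (n + n) → Subset (n + n)
      C-neighbours x =
        [ (λ a → N a ++ ⁅ f a ⁆) , (λ b → ⁅ proj₁ (f-onto b) ⁆ ++ N b) ]′ (splitAt n x)

      C-neighbours⇒Adj : (∀ {a w} → w ∈ N a → Adj G a w) →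
                         ∀ {x w} → w ∈ C-neighbours x → Adj (C G f) x w
      C-neighbours⇒Adj N⇒Adj {x} {w} w∈ with splitAt n x
      ... | inj₁ a with splitAt n w | ∈-++⁻ (N a) ⁅ f a ⁆ w∈
      ...   | inj₁ i | i∈ = N⇒Adj i∈
      ...   | inj₂ j | j∈ = x∈⁅y⁆⇒x≡y (f a) j∈
      C-neighbours⇒Adj N⇒Adj {x} {w} w∈ | inj₂ b
        with splitAt n w | ∈-++⁻ ⁅ proj₁ (f-onto b) ⁆ (N b) w∈
      ...   | inj₁ i | i∈ rewrite x∈⁅y⁆⇒x≡y _ i∈ = sym (proj₂ (f-onto b))
      ...   | inj₂ j | j∈ = N⇒Adj j∈

      δ<∣C-neighbours∣ : ∀ {δ} → (∀ a → δ ≤ ∣ N a ∣) → ∀ x → suc δ ≤ ∣ C-neighbours x ∣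
      δ<∣C-neighbours∣ {δ} δ≤∣N∣ x with splitAt n x
      ... | inj₁ a = begin
        suc δ                   ≤⟨ s≤s (δ≤∣N∣ a) ⟩
        suc ∣ N a ∣             ≡⟨ +-comm 1 ∣ N a ∣ ⟩
        ∣ N a ∣ + 1             ≡⟨ cong (∣ N a ∣ +_) (∣⁅x⁆∣≡1 (f a)) ⟨
        ∣ N a ∣ + ∣ ⁅ f a ⁆ ∣   ≡⟨ ∣p++q∣≡∣p∣+∣q∣ (N a) ⁅ f a ⁆ ⟨
        ∣ N a ++ ⁅ f a ⁆ ∣      ∎
        where open ≤-Reasoning
      ... | inj₂ b = begin
        suc δ                   ≤⟨ s≤s (δ≤∣N∣ b) ⟩
        1 + ∣ N b ∣             ≡⟨ cong (_+ ∣ N b ∣) (∣⁅x⁆∣≡1 c) ⟨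
        ∣ ⁅ c ⁆ ∣ + ∣ N b ∣     ≡⟨ ∣p++q∣≡∣p∣+∣q∣ ⁅ c ⁆ (N b) ⟨
        ∣ ⁅ c ⁆ ++ N b ∣        ∎
        where
        c = proj₁ (f-onto b)
        open ≤-Reasoning

∈∁⁅⁆⇒K-Adj : ∀ {a w : Fin m} → w ∈ ∁ ⁅ a ⁆ → Adj (K m) a w
∈∁⁅⁆⇒K-Adj w∈ a≡w = x∉⁅y⁆⇒x≢y (x∈∁p⇒x∉p w∈) (sym a≡w)

∣∁⁅x⁆∣≡n : ∀ {n} (x : Fin (suc n)) → ∣ ∁ ⁅ x ⁆ ∣ ≡ n
∣∁⁅x⁆∣≡n {n} x = trans (∣∁p∣≡n∸∣p∣ ⁅ x ⁆) (cong (suc n ∸_) (∣⁅x⁆∣≡1 x))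

proposition4p1 : (n : ℕ) → 3 ≤ n → (σ : Fin n ⤖ Fin n) →
    ZeroForcingNumber≡ (C (K n) (Bijection.to σ)) n
proposition4p1 zero    ()  σ
proposition4p1 (suc k) _   σ =
  (firstCopy (suc k) , firstCopy-isZeroForcingSet Kₙ f onto , ∣firstCopy∣≡n (suc k)) ,
  λ S zfs → δ≤∣zeroForcingSet∣ (C Kₙ f) (C-Adj? Kₙ f K-Adj?) S
              (C-neighbours Kₙ f onto N) (λ {x} → C-neighbours⇒Adj Kₙ f onto N ∈∁⁅⁆⇒K-Adj {x})
              (δ<∣C-neighbours∣ Kₙ f onto N (λ a → ≤-reflexive (sym (∣∁⁅x⁆∣≡n a))))
              zero zfs
  where
  Kₙ = K (suc k)
  f = Bijection.to σ
  onto = Bijection.strictlySurjective σ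
  N : Fin (suc k) → Subset (suc k)
  N a = ∁ ⁅ a ⁆
  K-Adj? : ∀ u w → Dec (Adj Kₙ u w)
  K-Adj? u w = ¬? (u ≟ w)
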